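{- Let $w\in\tilde S_n$ and let $uv$ be an affine factorization of $w$ into two cyclically decreasing factors $u,v$ (so $w=uv$ and $\ell(w)=\ell(u)+\ell(v)$). Then either $w\in S_{\hat x}$ for some $x\in[n]$, or there exist $b\in[n]$ and an integer $t\ge1$ such that $b-1,b-2,\dots,b-t\in\mathrm{con}(u)$, $b,b-1,\dots,b-t+1\in\mathrm{con}(v)$, $b\notin\mathrm{con}(u)$ and $b-t\notin\mathrm{con}(v)$.
   Context: Fix $n\ge2$; letters are taken modulo $n$ in $[n]=\{0,\dots,n-1\}$. $\tilde S_n$ is the affine symmetric group generated by $s_0,\dots,s_{n-1}$ ($s_i^2=1$, $s_is_{i+1}s_i=s_{i+1}s_is_{i+1}$, $s_is_j=s_js_i$ for $|i-j|>1$, indices mod $n$). $\ell$ is length and $\mathrm{con}(w)$ the set of letters in a reduced word of $w$. An element is cyclically decreasing if it equals $s_{i_1}\cdots s_{i_p}$ for a word with no repeated letter in which, for no $j$, $j-1$ occurs to the left of $j$. For $x\in[n]$, $S_{\hat x}$ is the subgroup generated by $\{s_i:i\neq x\}$. -}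

module Defs where

open import Data.Nat using (ℕ; zero; suc; _≤_)
open import Data.Fin using (Fin; zero; suc; fromℕ; inject₁)
open import Data.List using (List; []; _∷_; _++_; length)
open import Data.List.Membership.Propositional using (_∈_; _∉_)
open import Data.List.Relation.Unary.Unique.Propositional using (Unique)
open import Data.Product using (Σ; _×_)
open import Data.Empty using (⊥)
open import Relation.Binary.PropositionalEquality using (_≡_; _≢_)
open import Relation.Binary.Construct.Closure.Equivalence using (EqClosure)

cpred : ∀ {n} → Fin n → Fin n
cpred {suc k} zero    = fromℕ k
cpred {suc k} (suc i) = inject₁ i

_⊖_ : ∀ {n} → Fin n → ℕ → Fin n
i ⊖ zero  = i
i ⊖ suc k = cpred (i ⊖ k)

Word : ℕ → Set
Word n = List (Fin n)

-- One application of a defining relation of the affine symmetric group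
-- (Coxeter presentation; the braid relation s_{j-1} s_j s_{j-1} = s_j s_{j-1} s_j
-- only for n ≥ 3, since for n = 2 the Coxeter graph edge has label ∞).
data Step {n : ℕ} : Word n → Word n → Set where
  square : ∀ (p q : Word n) (i : Fin n) → Step (p ++ i ∷ i ∷ q) (p ++ q)
  braid  : 3 ≤ n → ∀ (p q : Word n) (j : Fin n) →
           Step (p ++ cpred j ∷ j ∷ cpred j ∷ q) (p ++ j ∷ cpred j ∷ j ∷ q)
  comm   : ∀ (p q : Word n) (i j : Fin n) → i ≢ j → i ≢ cpred j → j ≢ cpred i →
           Step (p ++ i ∷ j ∷ q) (p ++ j ∷ i ∷ q)

_≈_ : ∀ {n} → Word n → Word n → Set
_≈_ {n} = EqClosure (Step {n})

infix 4 _≈_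

Reduced : ∀ {n} → Word n → Set
Reduced {n} r = ∀ (r' : Word n) → r' ≈ r → length r ≤ length r'

IsLength : ∀ {n} → Word n → ℕ → Set
IsLength {n} w k = Σ (Word n) λ r → r ≈ w × Reduced r × length r ≡ k

InCon : ∀ {n} → Word n → Fin n → Set
InCon {n} w i = Σ (Word n) λ r → r ≈ w × Reduced r × i ∈ r

InParabolic : ∀ {n} → Fin n → Word n → Set
InParabolic {n} x w = Σ (Word n) λ r → r ≈ w × x ∉ r

CycDecWord : ∀ {n} → Word n → Set
CycDecWord {n} c = Unique c ×
  (∀ (j : Fin n) (p q : Word n) → c ≡ p ++ q → cpred j ∈ p → j ∈ q → ⊥)

CycDec : ∀ {n} → Word n → Set
CycDec {n} w = Σ (Word n) λ c → c ≈ w × CycDecWord c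

module Submission where

-- Lemma 3.13: if w = uv with u, v cyclically decreasing, then either w lies
-- in a maximal parabolic subgroup S_x̂, or there are b and t ≥ 1 with
-- b - 1, …, b - t ∈ con(u), b, …, b - t + 1 ∈ con(v), b ∉ con(u), b - t ∉ con(v).
--
-- Fix cyclically decreasing words cu, cv for u and v.  If some letter x
-- occurs in neither, then cu cv is a word for w avoiding x.  Otherwise every
-- letter occurs in cu or cv, and since cu misses some letter and cv misses
-- some letter, walking down the cycle of letters from a letter missing in cu
-- produces the required run b, …, b - t.  This only needs that con of a
-- cyclically decreasing element is the set of letters of its word.
--
-- The affine symmetric group acts on
-- ℤ/2n (points Bool × Fin n), so every word acts and equivalent words act
-- alike.  Generators other than s_x preserve the block (x, x + n]; if
-- c = c₁ x c₂ is cyclically decreasing, then c moves the point x + 1 out of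
-- that block.  Hence every word for c contains each letter of c, so c is
-- reduced and its letters are exactly con of its element.

open import Defs
open import Data.Bool using (Bool; true; false; not; _xor_)
open import Data.Bool.Properties
  using (not-involutive; not-¬; xor-annihilates-not; not-distribˡ-xor; not-distribʳ-xor)
open import Data.Nat as ℕ using (ℕ; zero; suc; _≤_; _<_; _+_; _∸_; _<ᵇ_; z≤n; s≤s; s<s)
import Data.Nat.Properties as ℕₚ
open import Data.Fin using (Fin; zero; suc; fromℕ; inject₁; toℕ; _≟_)
open import Data.Fin.Properties using (toℕ-injective; toℕ-inject₁; toℕ-fromℕ; ≤fromℕ; all?; ¬∀⟶∃¬)
open import Data.List using (List; []; _∷_; _++_; [_]; length)
open import Data.List.Properties using (++-assoc; length-++-sucʳ)
open import Data.List.Relation.Unary.Any using (here; there; any?)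
open import Data.List.Relation.Unary.Unique.Propositional using (Unique)
open import Data.List.Relation.Unary.AllPairs using (_∷_)
open import Data.List.Relation.Unary.All.Properties using (¬Any⇒All¬)
open import Data.List.Relation.Unary.Unique.Propositional.Properties using (Unique[x∷xs]⇒x∉xs)
open import Data.List.Membership.Propositional using (_∈_; _∉_)
open import Data.List.Membership.Propositional.Properties using (∈-∃++; ∈-++⁺ˡ; ∈-++⁺ʳ; ∈-++⁻)
import Data.List.Relation.Binary.Permutation.Setoid.Properties as Perm
open import Relation.Binary.Construct.Closure.ReflexiveTransitive using (ε; _◅_; _◅◅_)
import Relation.Binary.Construct.Closure.Equivalence as EqClosure
open import Relation.Binary.Construct.Closure.Symmetric using (fwd; bwd)
open import Data.Product using (Σ; _×_; _,_; proj₁; proj₂)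
open import Data.Sum using (_⊎_; inj₁; inj₂)
open import Data.Empty using (⊥-elim)
open import Relation.Nullary using (¬_; yes; no; Dec)
open import Relation.Nullary.Decidable using (_⊎-dec_)
open import Relation.Binary.PropositionalEquality hiding ([_])

-- bump j is suc j, except that zero (a successor that wrapped around) stays zero.
bump : ∀ {m} → Fin (suc m) → Fin (suc (suc m))
bump zero    = zero
bump (suc j) = suc (suc j)

csuc : ∀ {n} → Fin n → Fin n
csuc {suc zero}    zero    = zero
csuc {suc (suc m)} zero    = suc zero
csuc {suc (suc m)} (suc i) = bump (csuc i)

cpred-bump : ∀ {m} (y : Fin (suc m)) → cpred (bump y) ≡ suc (cpred y)
cpred-bump zero    = refl
cpred-bump (suc j) = refl

cpred-csuc : ∀ {n} (i : Fin n) → cpred (csuc i) ≡ i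
cpred-csuc {suc zero}    zero    = refl
cpred-csuc {suc (suc m)} zero    = refl
cpred-csuc {suc (suc m)} (suc i) = trans (cpred-bump (csuc i)) (cong suc (cpred-csuc i))

csuc-fromℕ : ∀ m → csuc (fromℕ m) ≡ zero
csuc-fromℕ zero    = refl
csuc-fromℕ (suc m) = cong bump (csuc-fromℕ m)

csuc-inject₁ : ∀ {m} (i : Fin (suc m)) → csuc {suc (suc m)} (inject₁ i) ≡ suc i
csuc-inject₁         zero    = refl
csuc-inject₁ {suc m} (suc i) = cong bump (csuc-inject₁ i)

csuc-cpred : ∀ {n} (i : Fin n) → csuc (cpred i) ≡ i
csuc-cpred {suc zero}    zero    = refl
csuc-cpred {suc (suc m)} zero    = cong bump (csuc-fromℕ m)
csuc-cpred {suc (suc m)} (suc i) = csuc-inject₁ i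

cpred-injective : ∀ {n} {i j : Fin n} → cpred i ≡ cpred j → i ≡ j
cpred-injective {i = i} {j} e = trans (sym (csuc-cpred i)) (trans (cong csuc e) (csuc-cpred j))

cpred-irrefl : ∀ {n} → 2 ≤ n → (i : Fin n) → cpred i ≢ i
cpred-irrefl {suc zero}    (s≤s ()) zero
cpred-irrefl {suc (suc m)} _ zero    ()
cpred-irrefl {suc (suc m)} _ (suc i) e =
  ℕₚ.1+n≢n (sym (trans (sym (toℕ-inject₁ i)) (cong toℕ e)))

cpred²-irrefl : ∀ {n} → 3 ≤ n → (i : Fin n) → cpred (cpred i) ≢ i
cpred²-irrefl {suc zero}          (s≤s ())      zero
cpred²-irrefl {suc (suc zero)}    (s≤s (s≤s ())) _
cpred²-irrefl {suc (suc (suc m))} _ zero          ()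
cpred²-irrefl {suc (suc (suc m))} _ (suc zero)    ()
cpred²-irrefl {suc (suc (suc m))} _ (suc (suc i)) e =
  ℕₚ.m≢1+n+m (toℕ i) {1} (trans (sym (trans (toℕ-inject₁ (inject₁ i)) (toℕ-inject₁ i))) (cong toℕ e))

csuc-irrefl : ∀ {n} → 2 ≤ n → (i : Fin n) → csuc i ≢ i
csuc-irrefl h i e = cpred-irrefl h i (sym (trans (sym (cpred-csuc i)) (cong cpred e)))

csuc≢cpred : ∀ {n} → 3 ≤ n → (i : Fin n) → csuc i ≢ cpred i
csuc≢cpred h i e = cpred²-irrefl h i (sym (trans (sym (cpred-csuc i)) (cong cpred e)))

⊖-+ : ∀ {n} (b : Fin n) k j → (b ⊖ k) ⊖ j ≡ b ⊖ (j + k)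
⊖-+ b k zero    = refl
⊖-+ b k (suc j) = cong cpred (⊖-+ b k j)

toℕ-cpred : ∀ {m} (y : Fin (suc m)) → 1 ≤ toℕ y → toℕ (cpred y) ≡ ℕ.pred (toℕ y)
toℕ-cpred (suc j) _ = toℕ-inject₁ j

toℕ-⊖ : ∀ {m} (b : Fin (suc m)) k → k ≤ toℕ b → toℕ (b ⊖ k) ≡ toℕ b ∸ k
toℕ-⊖ b zero    _   = refl
toℕ-⊖ b (suc k) k<b = begin
  toℕ (cpred (b ⊖ k))     ≡⟨ toℕ-cpred (b ⊖ k) (subst (1 ≤_) (sym b⊖k≡) (ℕₚ.m<n⇒0<n∸m k<b)) ⟩
  ℕ.pred (toℕ (b ⊖ k))    ≡⟨ cong ℕ.pred b⊖k≡ ⟩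
  ℕ.pred (toℕ b ∸ k)      ≡⟨ ℕₚ.pred[m∸n]≡m∸[1+n] (toℕ b) k ⟩
  toℕ b ∸ suc k           ∎
  where
  open ≡-Reasoning
  b⊖k≡ : toℕ (b ⊖ k) ≡ toℕ b ∸ k
  b⊖k≡ = toℕ-⊖ b k (ℕₚ.<⇒≤ k<b)

⊖-surjective : ∀ {n} (b c : Fin n) → Σ ℕ λ e → b ⊖ e ≡ c
⊖-surjective {suc m} b c = (m ∸ toℕ c) + suc (toℕ b) , (begin
  b ⊖ ((m ∸ toℕ c) + suc (toℕ b))   ≡⟨ sym (⊖-+ b (suc (toℕ b)) (m ∸ toℕ c)) ⟩
  (b ⊖ suc (toℕ b)) ⊖ (m ∸ toℕ c)   ≡⟨ cong (λ y → cpred y ⊖ (m ∸ toℕ c)) b⊖b≡0 ⟩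
  fromℕ m ⊖ (m ∸ toℕ c)             ≡⟨ toℕ-injective last⊖ ⟩
  c                                 ∎)
  where
  open ≡-Reasoning
  b⊖b≡0 : b ⊖ toℕ b ≡ zero
  b⊖b≡0 = toℕ-injective (trans (toℕ-⊖ b (toℕ b) ℕₚ.≤-refl) (ℕₚ.n∸n≡0 (toℕ b)))
  c≤m : toℕ c ≤ m
  c≤m = subst (toℕ c ≤_) (toℕ-fromℕ m) (≤fromℕ c)
  last⊖ : toℕ (fromℕ m ⊖ (m ∸ toℕ c)) ≡ toℕ c
  last⊖ = begin
    toℕ (fromℕ m ⊖ (m ∸ toℕ c)) ≡⟨ toℕ-⊖ (fromℕ m) (m ∸ toℕ c) (subst (m ∸ toℕ c ≤_) (sym (toℕ-fromℕ m)) (ℕₚ.m∸n≤m m (toℕ c))) ⟩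
    toℕ (fromℕ m) ∸ (m ∸ toℕ c) ≡⟨ cong (_∸ (m ∸ toℕ c)) (toℕ-fromℕ m) ⟩
    m ∸ (m ∸ toℕ c)             ≡⟨ ℕₚ.m∸[m∸n]≡n c≤m ⟩
    toℕ c                       ∎

≈-sym : ∀ {n} {u v : Word n} → u ≈ v → v ≈ u
≈-sym {n} = EqClosure.symmetric (Step {n})

step-prefix : ∀ {n} (z : Word n) {a b : Word n} → Step a b → Step (z ++ a) (z ++ b)
step-prefix z (square P Q i) = subst₂ Step (++-assoc z P _) (++-assoc z P Q) (square (z ++ P) Q i)
step-prefix z (braid h P Q j) = subst₂ Step (++-assoc z P _) (++-assoc z P _) (braid h (z ++ P) Q j)
step-prefix z (comm P Q i j d₁ d₂ d₃) = subst₂ Step (++-assoc z P _) (++-assoc z P _) (comm (z ++ P) Q i j d₁ d₂ d₃)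

step-suffix : ∀ {n} (z : Word n) {a b : Word n} → Step a b → Step (a ++ z) (b ++ z)
step-suffix z (square P Q i) = subst₂ Step (sym (++-assoc P _ z)) (sym (++-assoc P Q z)) (square P (Q ++ z) i)
step-suffix z (braid h P Q j) = subst₂ Step (sym (++-assoc P _ z)) (sym (++-assoc P _ z)) (braid h P (Q ++ z) j)
step-suffix z (comm P Q i j d₁ d₂ d₃) = subst₂ Step (sym (++-assoc P _ z)) (sym (++-assoc P _ z)) (comm P (Q ++ z) i j d₁ d₂ d₃)

≈-++ : ∀ {n} {a a′ b b′ : Word n} → a ≈ a′ → b ≈ b′ → a ++ b ≈ a′ ++ b′
≈-++ {a′ = a′} {b = b} a≈a′ b≈b′ =
  EqClosure.gmap (_++ b) (step-suffix b) a≈a′ ◅◅ EqClosure.gmap (a′ ++_) (step-prefix a′) b≈b′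

_∈?_ : ∀ {n} (x : Fin n) (w : Word n) → Dec (x ∈ w)
x ∈? w = any? (x ≟_) w

unique-removed : ∀ {A : Set} {x : A} (xs ys : List A) → Unique (xs ++ x ∷ ys) → x ∉ xs ++ ys
unique-removed xs ys u =
  Unique[x∷xs]⇒x∉xs (Perm.Unique-resp-↭ (setoid _) (Perm.↭-shift (setoid _) xs ys) u)

unique-length : ∀ {A : Set} {xs ys : List A} → Unique xs → (∀ {y} → y ∈ xs → y ∈ ys) → length xs ≤ length ys
unique-length {xs = []}     _              _   = z≤n
unique-length {xs = x ∷ xs} u@(_ ∷ uniq) sub with ∈-∃++ (sub (here refl))
... | ys₁ , ys₂ , refl =
  subst (suc (length xs) ≤_) (sym (length-++-sucʳ ys₁ x ys₂)) (s≤s (unique-length uniq sub′))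
  where
  sub′ : ∀ {y} → y ∈ xs → y ∈ ys₁ ++ ys₂
  sub′ {y} y∈xs with Perm.∈-resp-↭ (setoid _) (Perm.↭-shift (setoid _) ys₁ ys₂) (sub (there y∈xs))
  ... | here y≡x  = ⊥-elim (Unique[x∷xs]⇒x∉xs u (subst (_∈ xs) y≡x y∈xs))
  ... | there y∈  = y∈

-- A point (b , r) stands for the residue r + n·b modulo 2n.  The affine
-- symmetric group acts on ℤ (s_i exchanges i + kn and i + 1 + kn for all k);
-- this action commutes with translation by n, hence descends to ℤ/2n.
Point : ℕ → Set
Point n = Bool × Fin n

residue : ∀ {n} → Point n → Fin n
residue = proj₂

-- Passing the wrap-around position between n - 1 and 0 changes the sheet.
flipAt : ∀ {n} → Fin n → Bool → Bool
flipAt zero    b = not b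
flipAt (suc _) b = b

flipAt-involutive : ∀ {n} (r : Fin n) b → flipAt r (flipAt r b) ≡ b
flipAt-involutive zero    b = not-involutive b
flipAt-involutive (suc _) b = refl

up : ∀ {n} → Point n → Point n
up (b , r) = flipAt (csuc r) b , csuc r

down : ∀ {n} → Point n → Point n
down (b , r) = flipAt r b , cpred r

down-up : ∀ {n} (p : Point n) → down (up p) ≡ p
down-up (b , r) = cong₂ _,_ (flipAt-involutive (csuc r) b) (cpred-csuc r)

up-down : ∀ {n} (p : Point n) → up (down p) ≡ p
up-down (b , r) rewrite csuc-cpred r = cong (_, r) (flipAt-involutive r b)

gen : ∀ {n} → Fin n → Point n → Point n
gen i (b , r) with r ≟ i | cpred r ≟ i
... | yes _ | _     = up (b , r)
... | no _  | yes _ = down (b , r)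
... | no _  | no _  = (b , r)

gen-up : ∀ {n} {i : Fin n} (p : Point n) → residue p ≡ i → gen i p ≡ up p
gen-up {i = i} (b , r) r≡i with r ≟ i
... | yes _   = refl
... | no r≢i  = ⊥-elim (r≢i r≡i)

gen-down : ∀ {n} {i : Fin n} (p : Point n) → residue p ≢ i → cpred (residue p) ≡ i →
           gen i p ≡ down p
gen-down {i = i} (b , r) r≢i r-1≡i with r ≟ i | cpred r ≟ i
... | yes r≡i | _          = ⊥-elim (r≢i r≡i)
... | no _    | yes _      = refl
... | no _    | no r-1≢i   = ⊥-elim (r-1≢i r-1≡i)

gen-fix : ∀ {n} {i : Fin n} (p : Point n) → residue p ≢ i → cpred (residue p) ≢ i →
          gen i p ≡ p
gen-fix {i = i} (b , r) r≢i r-1≢i with r ≟ i | cpred r ≟ i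
... | yes r≡i | _         = ⊥-elim (r≢i r≡i)
... | no _    | yes r-1≡i = ⊥-elim (r-1≢i r-1≡i)
... | no _    | no _      = refl

data Position {n} (i : Fin n) (p : Point n) : Set where
  at    : residue p ≡ i → Position i p
  above : residue p ≢ i → cpred (residue p) ≡ i → Position i p
  away  : residue p ≢ i → cpred (residue p) ≢ i → Position i p

position : ∀ {n} (i : Fin n) (p : Point n) → Position i p
position i (b , r) with r ≟ i | cpred r ≟ i
... | yes r≡i | _         = at r≡i
... | no r≢i  | yes r-1≡i = above r≢i r-1≡i
... | no r≢i  | no r-1≢i  = away r≢i r-1≢i

gen-involutive : ∀ {n} → 2 ≤ n → (i : Fin n) (p : Point n) → gen i (gen i p) ≡ p
gen-involutive h i p@(b , r) with position i p
... | at r≡i = begin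
  gen i (gen i p) ≡⟨ cong (gen i) (gen-up p r≡i) ⟩
  gen i (up p)    ≡⟨ gen-down (up p) (λ e → csuc-irrefl h r (trans e (sym r≡i)))
                                     (trans (cpred-csuc r) r≡i) ⟩
  down (up p)     ≡⟨ down-up p ⟩
  p               ∎
  where open ≡-Reasoning
... | above r≢i r-1≡i = begin
  gen i (gen i p) ≡⟨ cong (gen i) (gen-down p r≢i r-1≡i) ⟩
  gen i (down p)  ≡⟨ gen-up (down p) r-1≡i ⟩
  up (down p)     ≡⟨ up-down p ⟩
  p               ∎
  where open ≡-Reasoning
... | away r≢i r-1≢i = trans (cong (gen i) fixed) fixed
  where
  fixed : gen i p ≡ p
  fixed = gen-fix p r≢i r-1≢i

Distant : ∀ {n} → Fin n → Fin n → Set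
Distant i j = i ≢ j × i ≢ cpred j × j ≢ cpred i

distant-sym : ∀ {n} {i j : Fin n} → Distant i j → Distant j i
distant-sym (i≢j , i≢j-1 , j≢i-1) = (λ j≡i → i≢j (sym j≡i)) , j≢i-1 , i≢j-1

Moves : ∀ {n} → Fin n → Point n → Set
Moves i p = residue p ≡ i ⊎ (residue p ≢ i × cpred (residue p) ≡ i)

distant-fixes : ∀ {n} {i j : Fin n} → Distant i j → (p : Point n) → Moves i p →
                gen j p ≡ p × gen j (gen i p) ≡ gen i p
distant-fixes {i = i} {j} (i≢j , i≢j-1 , j≢i-1) p@(b , r) (inj₁ r≡i) =
  gen-fix p (λ r≡j → i≢j (trans (sym r≡i) r≡j))
            (λ r-1≡j → j≢i-1 (sym (trans (cong cpred (sym r≡i)) r-1≡j))) ,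
  subst (λ q → gen j q ≡ q) (sym (gen-up p r≡i))
        (gen-fix (up p) (λ r+1≡j → i≢j-1 (trans (sym r≡i) (trans (sym (cpred-csuc r)) (cong cpred r+1≡j))))
                        (λ r≡j → i≢j (trans (sym r≡i) (trans (sym (cpred-csuc r)) r≡j))))
distant-fixes {i = i} {j} (i≢j , i≢j-1 , j≢i-1) p@(b , r) (inj₂ (r≢i , r-1≡i)) =
  gen-fix p (λ r≡j → i≢j-1 (trans (sym r-1≡i) (cong cpred r≡j)))
            (λ r-1≡j → i≢j (trans (sym r-1≡i) r-1≡j)) ,
  subst (λ q → gen j q ≡ q) (sym (gen-down p r≢i r-1≡i))
        (gen-fix (down p) (λ r-1≡j → i≢j (trans (sym r-1≡i) r-1≡j))
                          (λ r-2≡j → j≢i-1 (sym (trans (cong cpred (sym r-1≡i)) r-2≡j))))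

comm-at-moved : ∀ {n} {i j : Fin n} → Distant i j → (p : Point n) → Moves i p →
                gen i (gen j p) ≡ gen j (gen i p)
comm-at-moved {i = i} {j} d p m = trans (cong (gen i) (proj₁ fixes)) (sym (proj₂ fixes))
  where
  fixes : gen j p ≡ p × gen j (gen i p) ≡ gen i p
  fixes = distant-fixes d p m

gen-comm : ∀ {n} (i j : Fin n) → Distant i j → (p : Point n) → gen i (gen j p) ≡ gen j (gen i p)
gen-comm i j d p with position i p | position j p
... | at r≡i          | _               = comm-at-moved d p (inj₁ r≡i)
... | above r≢i r-1≡i | _               = comm-at-moved d p (inj₂ (r≢i , r-1≡i))
... | away _ _        | at r≡j          = sym (comm-at-moved (distant-sym d) p (inj₁ r≡j))
... | away _ _        | above r≢j r-1≡j = sym (comm-at-moved (distant-sym d) p (inj₂ (r≢j , r-1≡j)))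
... | away r≢i r-1≢i  | away r≢j r-1≢j  = begin
  gen i (gen j p) ≡⟨ cong (gen i) (gen-fix p r≢j r-1≢j) ⟩
  gen i p         ≡⟨ gen-fix p r≢i r-1≢i ⟩
  p               ≡⟨ sym (gen-fix p r≢j r-1≢j) ⟩
  gen j p         ≡⟨ cong (gen j) (sym (gen-fix p r≢i r-1≢i)) ⟩
  gen j (gen i p) ∎
  where open ≡-Reasoning

module _ {n : ℕ} (h3 : 3 ≤ n) (j : Fin n) where
  private
    a : Fin n
    a = cpred j
    h2 : 2 ≤ n
    h2 = ℕₚ.<⇒≤ h3
    open ≡-Reasoning

  braid-below : (b : Bool) → let p = (b , a) in gen a (gen j (gen a p)) ≡ gen j (gen a (gen j p))
  braid-below b = begin
    gen a (gen j (gen a p)) ≡⟨ cong (λ q → gen a (gen j q)) a-up ⟩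
    gen a (gen j (up p))    ≡⟨ cong (gen a) j-up ⟩
    gen a (up (up p))       ≡⟨ gen-fix (up (up p)) j+1≢a j≢a ⟩
    up (up p)               ≡⟨ sym j-up ⟩
    gen j (up p)            ≡⟨ cong (gen j) (sym a-up) ⟩
    gen j (gen a p)         ≡⟨ cong (λ q → gen j (gen a q)) (sym (gen-fix p (cpred-irrefl h2 j) (cpred²-irrefl h3 j))) ⟩
    gen j (gen a (gen j p)) ∎
    where
    p : Point n
    p = (b , a)
    a-up : gen a p ≡ up p
    a-up = gen-up p refl
    j-up : gen j (up p) ≡ up (up p)
    j-up = gen-up (up p) (csuc-cpred j)
    -- up (up p) lies in the class of j + 1, which s_{j-1} does not move.
    j+1≢a : residue (up (up p)) ≢ a
    j+1≢a e = csuc≢cpred h3 j (trans (cong csuc (sym (csuc-cpred j))) e)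
    j≢a : cpred (residue (up (up p))) ≢ a
    j≢a e = cpred-irrefl h2 j (sym (trans (sym (csuc-cpred j)) (trans (sym (cpred-csuc _)) e)))

  braid-at : (b : Bool) → let p = (b , j) in gen a (gen j (gen a p)) ≡ gen j (gen a (gen j p))
  braid-at b = begin
    gen a (gen j (gen a p))  ≡⟨ cong (λ q → gen a (gen j q)) (gen-down p (λ e → cpred-irrefl h2 j (sym e)) refl) ⟩
    gen a (gen j (down p))   ≡⟨ cong (gen a) (gen-fix (down p) (cpred-irrefl h2 j) (cpred²-irrefl h3 j)) ⟩
    gen a (down p)           ≡⟨ gen-up (down p) refl ⟩
    up (down p)              ≡⟨ up-down p ⟩
    p                        ≡⟨ sym (down-up p) ⟩
    down (up p)              ≡⟨ sym (gen-down (up p) (csuc-irrefl h2 j) (cpred-csuc j)) ⟩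
    gen j (up p)             ≡⟨ cong (gen j) (sym (gen-fix (up p) (csuc≢cpred h3 j)
                                   (λ e → cpred-irrefl h2 j (sym (trans (sym (cpred-csuc j)) e))))) ⟩
    gen j (gen a (up p))     ≡⟨ cong (λ q → gen j (gen a q)) (sym (gen-up p refl)) ⟩
    gen j (gen a (gen j p))  ∎
    where
    p : Point n
    p = (b , j)

  braid-above : (p : Point n) → residue p ≢ a → cpred (residue p) ≢ a →
                cpred (residue p) ≡ j → residue p ≢ j →
                gen a (gen j (gen a p)) ≡ gen j (gen a (gen j p))
  braid-above p r≢a r-1≢a r-1≡j r≢j = begin
    gen a (gen j (gen a p))   ≡⟨ cong (λ q → gen a (gen j q)) a-fix ⟩
    gen a (gen j p)           ≡⟨ cong (gen a) j-down ⟩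
    gen a (down p)            ≡⟨ gen-down (down p) r-1≢a r-2≡a ⟩
    down (down p)             ≡⟨ sym (gen-fix (down (down p)) (λ e → cpred-irrefl h2 j (trans (sym r-2≡a) e))
                                    (λ e → cpred²-irrefl h3 j (trans (sym (cong cpred r-2≡a)) e))) ⟩
    gen j (down (down p))     ≡⟨ cong (gen j) (sym (gen-down (down p) r-1≢a r-2≡a)) ⟩
    gen j (gen a (down p))    ≡⟨ cong (λ q → gen j (gen a q)) (sym j-down) ⟩
    gen j (gen a (gen j p))   ∎
    where
    a-fix : gen a p ≡ p
    a-fix = gen-fix p r≢a r-1≢a
    j-down : gen j p ≡ down p
    j-down = gen-down p r≢j r-1≡j
    r-2≡a : cpred (cpred (residue p)) ≡ a
    r-2≡a = cong cpred r-1≡j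

  braid-away : (p : Point n) → residue p ≢ a → cpred (residue p) ≢ a →
               residue p ≢ j → cpred (residue p) ≢ j →
               gen a (gen j (gen a p)) ≡ gen j (gen a (gen j p))
  braid-away p r≢a r-1≢a r≢j r-1≢j = begin
    gen a (gen j (gen a p)) ≡⟨ cong (λ q → gen a (gen j q)) a-fix ⟩
    gen a (gen j p)         ≡⟨ cong (gen a) j-fix ⟩
    gen a p                 ≡⟨ a-fix ⟩
    p                       ≡⟨ sym j-fix ⟩
    gen j p                 ≡⟨ cong (gen j) (sym a-fix) ⟩
    gen j (gen a p)         ≡⟨ cong (λ q → gen j (gen a q)) (sym j-fix) ⟩
    gen j (gen a (gen j p)) ∎
    where
    a-fix : gen a p ≡ p
    a-fix = gen-fix p r≢a r-1≢a
    j-fix : gen j p ≡ p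
    j-fix = gen-fix p r≢j r-1≢j

gen-braid : ∀ {n} → 3 ≤ n → (j : Fin n) (p : Point n) →
            gen (cpred j) (gen j (gen (cpred j) p)) ≡ gen j (gen (cpred j) (gen j p))
gen-braid h3 j p@(b , r) with position (cpred j) p | position j p
... | at refl          | _                = braid-below h3 j b
... | above _ r-1≡j-1  | _                with cpred-injective r-1≡j-1
...   | refl = braid-at h3 j b
gen-braid h3 j p@(b , r) | away r≢a r-1≢a | at r≡j          = ⊥-elim (r-1≢a (cong cpred r≡j))
gen-braid h3 j p@(b , r) | away r≢a r-1≢a | above r≢j r-1≡j = braid-above h3 j p r≢a r-1≢a r-1≡j r≢j
gen-braid h3 j p@(b , r) | away r≢a r-1≢a | away r≢j r-1≢j  = braid-away h3 j p r≢a r-1≢a r≢j r-1≢j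

-- A word acts letter by letter, its rightmost letter first.
act : ∀ {n} → Word n → Point n → Point n
act []      p = p
act (i ∷ w) p = gen i (act w p)

act-++ : ∀ {n} (u v : Word n) (p : Point n) → act (u ++ v) p ≡ act u (act v p)
act-++ []      v p = refl
act-++ (i ∷ u) v p = cong (gen i) (act-++ u v p)

act-in-context : ∀ {n} (P Q : Word n) {x y : Word n} (p : Point n) →
                 act x (act Q p) ≡ act y (act Q p) → act (P ++ x ++ Q) p ≡ act (P ++ y ++ Q) p
act-in-context P Q {x} {y} p e = begin
  act (P ++ x ++ Q) p    ≡⟨ act-++ P (x ++ Q) p ⟩
  act P (act (x ++ Q) p) ≡⟨ cong (act P) (trans (act-++ x Q p) (trans e (sym (act-++ y Q p)))) ⟩
  act P (act (y ++ Q) p) ≡⟨ sym (act-++ P (y ++ Q) p) ⟩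
  act (P ++ y ++ Q) p    ∎
  where open ≡-Reasoning

act-step : ∀ {n} → 2 ≤ n → {u v : Word n} → Step u v → ∀ p → act u p ≡ act v p
act-step h (square P Q i) p =
  act-in-context P Q {i ∷ i ∷ []} {[]} p (gen-involutive h i (act Q p))
act-step h (braid h3 P Q j) p =
  act-in-context P Q {cpred j ∷ j ∷ cpred j ∷ []} {j ∷ cpred j ∷ j ∷ []} p (gen-braid h3 j (act Q p))
act-step h (comm P Q i j i≢j i≢j-1 j≢i-1) p =
  act-in-context P Q {i ∷ j ∷ []} {j ∷ i ∷ []} p (gen-comm i j (i≢j , i≢j-1 , j≢i-1) (act Q p))

act-≈ : ∀ {n} → 2 ≤ n → {u v : Word n} → u ≈ v → ∀ p → act u p ≡ act v p
act-≈ h ε              p = refl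
act-≈ h (fwd s ◅ rest) p = trans (act-step h s p) (act-≈ h rest p)
act-≈ h (bwd s ◅ rest) p = trans (sym (act-step h s p)) (act-≈ h rest p)

act-fix : ∀ {n} (w : Word n) (p : Point n) →
          (∀ {i} → i ∈ w → residue p ≢ i × cpred (residue p) ≢ i) → act w p ≡ p
act-fix []      p _        = refl
act-fix (i ∷ w) p unmoved =
  trans (cong (gen i) (act-fix w p (λ i∈w → unmoved (there i∈w))))
        (gen-fix p (proj₁ (unmoved (here refl))) (proj₂ (unmoved (here refl))))

<ᵇ-irrefl : ∀ a → (a <ᵇ a) ≡ false
<ᵇ-irrefl zero    = refl
<ᵇ-irrefl (suc a) = <ᵇ-irrefl a

<ᵇ-true : ∀ {a c} → a < c → (a <ᵇ c) ≡ true
<ᵇ-true {zero}  {suc c} _         = refl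
<ᵇ-true {suc a} {suc c} (s<s a<c) = <ᵇ-true a<c

<ᵇ-suc : ∀ {a c} → a ≢ c → (a <ᵇ c) ≡ (a <ᵇ suc c)
<ᵇ-suc {zero}  {zero}  a≢c = ⊥-elim (a≢c refl)
<ᵇ-suc {zero}  {suc c} _   = refl
<ᵇ-suc {suc a} {zero}  _   = refl
<ᵇ-suc {suc a} {suc c} a≢c = <ᵇ-suc (λ e → a≢c (cong suc e))

-- side x p records whether p lies in the block (x, x + n] of ℤ/2n.  Every
-- generator other than s_x maps this block to itself.
side : ∀ {n} → Fin n → Point n → Bool
side x (b , r) = b xor (toℕ x <ᵇ toℕ r)

side-down : ∀ {n} (x : Fin n) (p : Point n) → cpred (residue p) ≢ x → side x (down p) ≡ side x p
side-down {suc m} x (b , zero) r-1≢x = begin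
  not b xor (toℕ x <ᵇ toℕ (fromℕ m)) ≡⟨ cong (not b xor_) (<ᵇ-true (ℕₚ.≤∧≢⇒< (≤fromℕ x) (λ e → r-1≢x (sym (toℕ-injective e))))) ⟩
  not b xor not false                ≡⟨ xor-annihilates-not b false ⟩
  b xor false                        ∎
  where open ≡-Reasoning
side-down x (b , suc j) r-1≢x =
  cong (b xor_) (trans (cong (toℕ x <ᵇ_) (toℕ-inject₁ j))
                       (<ᵇ-suc (λ e → r-1≢x (toℕ-injective (trans (toℕ-inject₁ j) (sym e))))))

side-down-crossing : ∀ {n} (x : Fin n) (p : Point n) → cpred (residue p) ≡ x → side x (down p) ≡ not (side x p)
side-down-crossing {suc m} _ (b , zero) refl = begin
  not b xor (toℕ (fromℕ m) <ᵇ toℕ (fromℕ m)) ≡⟨ cong (not b xor_) (<ᵇ-irrefl (toℕ (fromℕ m))) ⟩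
  not b xor false                            ≡⟨ sym (not-distribˡ-xor b false) ⟩
  not (b xor false)                          ∎
  where open ≡-Reasoning
side-down-crossing _ (b , suc j) refl = begin
  b xor (toℕ (inject₁ j) <ᵇ toℕ (inject₁ j)) ≡⟨ cong (b xor_) (<ᵇ-irrefl (toℕ (inject₁ j))) ⟩
  b xor not true                             ≡⟨ sym (not-distribʳ-xor b true) ⟩
  not (b xor true)                           ≡⟨ cong (λ t → not (b xor t)) (sym (<ᵇ-true (ℕₚ.≤-reflexive (cong suc (toℕ-inject₁ j))))) ⟩
  not (b xor (toℕ (inject₁ j) <ᵇ suc (toℕ j))) ∎
  where open ≡-Reasoning

side-up : ∀ {n} (x : Fin n) (p : Point n) → residue p ≢ x → side x (up p) ≡ side x p
side-up x p@(b , r) r≢x = begin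
  side x (up p)        ≡⟨ sym (side-down x (up p) (λ e → r≢x (trans (sym (cpred-csuc r)) e))) ⟩
  side x (down (up p)) ≡⟨ cong (side x) (down-up p) ⟩
  side x p             ∎
  where open ≡-Reasoning

side-gen : ∀ {n} (x i : Fin n) (p : Point n) → i ≢ x → side x (gen i p) ≡ side x p
side-gen x i p i≢x with position i p
... | at r≡i           = trans (cong (side x) (gen-up p r≡i)) (side-up x p (λ r≡x → i≢x (trans (sym r≡i) r≡x)))
... | above r≢i r-1≡i  = trans (cong (side x) (gen-down p r≢i r-1≡i)) (side-down x p (λ e → i≢x (trans (sym r-1≡i) e)))
... | away r≢i r-1≢i   = cong (side x) (gen-fix p r≢i r-1≢i)

side-act : ∀ {n} (x : Fin n) (w : Word n) (p : Point n) → x ∉ w → side x (act w p) ≡ side x p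
side-act x []      p x∉w = refl
side-act x (i ∷ w) p x∉w =
  trans (side-gen x i (act w p) (λ i≡x → x∉w (here (sym i≡x)))) (side-act x w p (λ x∈w → x∉w (there x∈w)))

-- A word r avoiding x preserves sides at x; but writing
-- c = c₁ x c₂, the point x + 1 is fixed by c₂ (which contains neither x nor
-- x + 1), moved across the boundary by s_x, and kept on that side by c₁.
cycDec-letters-forced : ∀ {n} → 2 ≤ n → {c r : Word n} → CycDecWord c → r ≈ c →
                        ∀ {x} → x ∈ c → x ∈ r
cycDec-letters-forced h {c} {r} (uniq , noAscent) r≈c {x} x∈c with x ∈? r
... | yes x∈r = x∈r
... | no x∉r with ∈-∃++ x∈c
...   | c₁ , c₂ , refl = ⊥-elim (not-¬ refl side-flips)
  where
  p₀ : Point _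
  p₀ = (false , csuc x)
  x∉c₁++c₂ : x ∉ c₁ ++ c₂
  x∉c₁++c₂ = unique-removed c₁ c₂ uniq
  x+1∉c₂ : csuc x ∉ c₂
  x+1∉c₂ = noAscent (csuc x) (c₁ ++ [ x ]) c₂ (sym (++-assoc c₁ [ x ] c₂))
             (subst (_∈ c₁ ++ [ x ]) (sym (cpred-csuc x)) (∈-++⁺ʳ c₁ (here refl)))
  c₂-fixes : act c₂ p₀ ≡ p₀
  c₂-fixes = act-fix c₂ p₀ λ i∈c₂ →
    (λ x+1≡i → x+1∉c₂ (subst (_∈ c₂) (sym x+1≡i) i∈c₂)) ,
    (λ x≡i → x∉c₁++c₂ (∈-++⁺ʳ c₁ (subst (_∈ c₂) (sym (trans (sym (cpred-csuc x)) x≡i)) i∈c₂)))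
  side-flips : side x p₀ ≡ not (side x p₀)
  side-flips = begin
    side x p₀                          ≡⟨ sym (side-act x r p₀ x∉r) ⟩
    side x (act r p₀)                  ≡⟨ cong (side x) (act-≈ h r≈c p₀) ⟩
    side x (act (c₁ ++ x ∷ c₂) p₀)     ≡⟨ cong (side x) (act-++ c₁ (x ∷ c₂) p₀) ⟩
    side x (act c₁ (gen x (act c₂ p₀))) ≡⟨ cong (λ q → side x (act c₁ (gen x q))) c₂-fixes ⟩
    side x (act c₁ (gen x p₀))         ≡⟨ cong (λ q → side x (act c₁ q)) (gen-down p₀ (csuc-irrefl h x) (cpred-csuc x)) ⟩
    side x (act c₁ (down p₀))          ≡⟨ side-act x c₁ (down p₀) (λ x∈c₁ → x∉c₁++c₂ (∈-++⁺ˡ x∈c₁)) ⟩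
    side x (down p₀)                   ≡⟨ side-down-crossing x p₀ (cpred-csuc x) ⟩
    not (side x p₀)                    ∎
    where open ≡-Reasoning

cycDec-reduced : ∀ {n} → 2 ≤ n → {c : Word n} → CycDecWord c → Reduced c
cycDec-reduced h cd r r≈c = unique-length (proj₁ cd) (cycDec-letters-forced h cd r≈c)

inCon-letter : ∀ {n} → 2 ≤ n → {c w : Word n} {y : Fin n} → CycDecWord c → c ≈ w → y ∈ c → InCon w y
inCon-letter h {c} cd c≈w y∈c = c , c≈w , cycDec-reduced h cd , y∈c

not-inCon : ∀ {n} → 2 ≤ n → {c w : Word n} {y : Fin n} → CycDecWord c → c ≈ w → y ∉ c → ¬ InCon w y
not-inCon h {c} {w} {y} cd c≈w y∉c (r , r≈w , r-reduced , y∈r) =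
  ℕₚ.<-irrefl refl (ℕₚ.≤-trans longer (r-reduced c (c≈w ◅◅ ≈-sym r≈w)))
  where
  contained : ∀ {z} → z ∈ y ∷ c → z ∈ r
  contained (here refl) = y∈r
  contained (there z∈c) = cycDec-letters-forced h cd (r≈w ◅◅ ≈-sym c≈w) z∈c
  longer : suc (length c) ≤ length r
  longer = unique-length (¬Any⇒All¬ c y∉c ∷ proj₁ cd) contained

-- A cyclically decreasing word misses some letter: if it starts with y,
-- then y + 1 cannot occur in it.
cycDec-misses : ∀ {n} → 2 ≤ n → {c : Word n} → CycDecWord c → Σ (Fin n) λ y → y ∉ c
cycDec-misses {suc _} h {[]}    _              = zero , λ ()
cycDec-misses         h {y ∷ c} (_ , noAscent) = csuc y , y+1∉
  where
  y+1∉ : csuc y ∉ y ∷ c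
  y+1∉ (here y+1≡y)  = csuc-irrefl h y y+1≡y
  y+1∉ (there y+1∈c) = noAscent (csuc y) [ y ] c refl (here (cpred-csuc y)) y+1∈c

module Runs (P Q : ℕ → Set) (P? : ∀ k → Dec (P k)) (Q? : ∀ k → Dec (Q k))
            (cover : ∀ k → P k ⊎ Q k) where

  Run : Set
  Run = Σ ℕ λ s → Σ ℕ λ t → 1 ≤ t
      × (∀ k → 1 ≤ k → k ≤ t → P (k + s)) × (∀ k → k < t → Q (k + s)) × ¬ P s × ¬ Q (t + s)

  P-unless-Q : ∀ {k} → ¬ Q k → P k
  P-unless-Q {k} ¬Q with cover k
  ... | inj₁ p = p
  ... | inj₂ q = ⊥-elim (¬Q q)

  Q-unless-P : ∀ {k} → ¬ P k → Q k
  Q-unless-P {k} ¬P with cover k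
  ... | inj₁ p = ⊥-elim (¬P p)
  ... | inj₂ q = q

  snoc : ∀ {R : ℕ → Set} {t} → (∀ k → k ≤ t → R k) → R (suc t) → ∀ k → k ≤ suc t → R k
  snoc {t = t} R≤t Rt+1 k k≤t+1 with ℕₚ.m≤n⇒m<n∨m≡n k≤t+1
  ... | inj₁ k<t+1 = R≤t k (ℕₚ.≤-pred k<t+1)
  ... | inj₂ refl  = Rt+1

  -- Scan upwards from a position s where P fails, keeping the current
  -- candidate run [s, s + t] (P on (s, s + t], Q on [s, s + t]).  At the next
  -- position either Q fails (the run is complete), or both hold (extend), or
  -- P fails (restart there).  The fuel d bounds the distance to a failure of Q.
  scan : ∀ d s t → ¬ P s → (∀ k → k ≤ t → 1 ≤ k → P (k + s)) → (∀ k → k ≤ t → Q (k + s)) →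
         ¬ Q (d + (t + s)) → Run
  scan zero    s t _   _  Qs ¬Qend = ⊥-elim (¬Qend (Qs t ℕₚ.≤-refl))
  scan (suc d) s t ¬Ps Ps Qs ¬Qend with Q? (suc t + s) | P? (suc t + s)
  ... | no ¬Q | _ = s , suc t , s≤s z≤n ,
                    (λ k 1≤k k≤t+1 → snoc Ps (λ _ → P-unless-Q ¬Q) k k≤t+1 1≤k) ,
                    (λ k k<t+1 → Qs k (ℕₚ.≤-pred k<t+1)) , ¬Ps , ¬Q
  ... | yes q | yes p = scan d s (suc t) ¬Ps (snoc Ps (λ _ → p)) (snoc Qs q) ¬Qnext
    where
    ¬Qnext : ¬ Q (d + (suc t + s))
    ¬Qnext = subst (λ k → ¬ Q k) (sym (ℕₚ.+-suc d (t + s))) ¬Qend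
  ... | yes q | no ¬p = scan d (suc t + s) 0 ¬p (λ { _ z≤n () }) (λ { _ z≤n → q }) ¬Qnext
    where
    ¬Qnext : ¬ Q (d + (suc t + s))
    ¬Qnext = subst (λ k → ¬ Q k) (sym (ℕₚ.+-suc d (t + s))) ¬Qend

  find-run : ¬ P 0 → ∀ e → ¬ Q e → Run
  find-run ¬P0 e ¬Qe = scan e 0 0 ¬P0 (λ { _ z≤n () }) (λ { _ z≤n → Q-unless-P ¬P0 })
                            (subst (λ k → ¬ Q k) (sym (ℕₚ.+-identityʳ e)) ¬Qe)

ConRun : ∀ {n} → Word n → Word n → Set
ConRun {n} u v = Σ (Fin n) λ b → Σ ℕ λ t → 1 ≤ t
  × (∀ k → 1 ≤ k → k ≤ t → InCon u (b ⊖ k))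
  × (∀ k → k < t → InCon v (b ⊖ k))
  × ¬ InCon u b
  × ¬ InCon v (b ⊖ t)

-- Start at a letter b₀ missing from cu and walk down the cycle; some letter
-- missing from cv is reached, since k ↦ b₀ ⊖ k is onto.
covered-conRun : ∀ {n} → 2 ≤ n → {cu cv u v : Word n} →
                 CycDecWord cu → cu ≈ u → CycDecWord cv → cv ≈ v →
                 (∀ x → x ∈ cu ⊎ x ∈ cv) → ConRun u v
covered-conRun h {cu} {cv} cdu cu≈u cdv cv≈v covered =
  to-con (find-run (proj₂ missing-u) (proj₁ reaches-c₀)
                   (λ b₀⊖e∈cv → proj₂ missing-v (subst (_∈ cv) (proj₂ reaches-c₀) b₀⊖e∈cv)))
  where
  missing-u : Σ (Fin _) λ y → y ∉ cu
  missing-u = cycDec-misses h cdu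
  missing-v : Σ (Fin _) λ y → y ∉ cv
  missing-v = cycDec-misses h cdv
  b₀ : Fin _
  b₀ = proj₁ missing-u
  reaches-c₀ : Σ ℕ λ e → b₀ ⊖ e ≡ proj₁ missing-v
  reaches-c₀ = ⊖-surjective b₀ (proj₁ missing-v)
  open Runs (λ k → b₀ ⊖ k ∈ cu) (λ k → b₀ ⊖ k ∈ cv) (λ k → (b₀ ⊖ k) ∈? cu) (λ k → (b₀ ⊖ k) ∈? cv)
            (λ k → covered (b₀ ⊖ k))
  to-con : Run → ConRun _ _
  to-con (s , t , 1≤t , Ps , Qs , ¬Ps , ¬Qt) =
    b₀ ⊖ s , t , 1≤t ,
    (λ k 1≤k k≤t → inCon-letter h cdu cu≈u (shifted k (Ps k 1≤k k≤t))) ,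
    (λ k k<t → inCon-letter h cdv cv≈v (shifted k (Qs k k<t))) ,
    not-inCon h cdu cu≈u ¬Ps ,
    not-inCon h cdv cv≈v (λ b⊖t∈cv → ¬Qt (subst (_∈ cv) (⊖-+ b₀ s t) b⊖t∈cv))
    where
    shifted : ∀ k {c} → b₀ ⊖ (k + s) ∈ c → (b₀ ⊖ s) ⊖ k ∈ c
    shifted k {c} = subst (_∈ c) (sym (⊖-+ b₀ s k))

lemma3p13 : (n : ℕ) → 2 ≤ n → (w u v : Word n) →
    CycDec u → CycDec v → w ≈ u ++ v →
    (lw lu lv : ℕ) → IsLength w lw → IsLength u lu → IsLength v lv → lw ≡ lu + lv →
    (Σ (Fin n) λ x → InParabolic x w)
    ⊎ (Σ (Fin n) λ b → Σ ℕ λ t → 1 ≤ t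
        × (∀ k → 1 ≤ k → k ≤ t → InCon u (b ⊖ k))
        × (∀ k → k < t → InCon v (b ⊖ k))
        × ¬ InCon u b
        × ¬ InCon v (b ⊖ t))
lemma3p13 n h w u v (cu , cu≈u , cdu) (cv , cv≈v , cdv) w≈uv _ _ _ _ _ _ _
  with all? (λ x → x ∈? cu ⊎-dec x ∈? cv)
... | yes covered  = inj₂ (covered-conRun h cdu cu≈u cdv cv≈v covered)
... | no ¬covered = inj₁ (x , cu ++ cv , ≈-sym (w≈uv ◅◅ ≈-++ (≈-sym cu≈u) (≈-sym cv≈v)) , x∉cu++cv)
  where
  uncovered : Σ (Fin n) λ x → ¬ (x ∈ cu ⊎ x ∈ cv)
  uncovered = ¬∀⟶∃¬ n _ (λ x → x ∈? cu ⊎-dec x ∈? cv) ¬covered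
  x : Fin n
  x = proj₁ uncovered
  x∉cu++cv : x ∉ cu ++ cv
  x∉cu++cv x∈ = proj₂ uncovered (∈-++⁻ cu x∈)
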